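{- For every $n\ge 1$, the set ${\cal ODCT}_n$ of full transformations of $X_n=\{1,\dots,n\}$ that are order-preserving, order-decreasing and contractions satisfies $|{\cal ODCT}_n|=2^{n-1}$.
   Context: Full transformations are maps $\alpha:X_n\to X_n$, written $x\mapsto x\alpha$. Order-preserving: $x\le y\Rightarrow x\alpha\le y\alpha$. Order-decreasing: $x\alpha\le x$ for all $x$. Contraction: $|x\alpha-y\alpha|\le|x-y|$ for all $x,y$. -}

module Defs where

open import Data.Nat using (ℕ)
open import Data.Fin using (Fin; toℕ; _≤_)
open import Data.Vec using (Vec; lookup)
open import Data.Product using (_×_; Σ)
open import Relation.Binary.PropositionalEquality using (_≡_)
open import Data.List using (List; length)
open import Data.List.Membership.Propositional using (_∈_)
open import Data.List.Relation.Unary.Unique.Propositional using (Unique)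
open import Data.Integer using (ℤ; +_; _-_; ∣_∣)
import Data.Nat as ℕ

-- A full transformation of X_n = {1,…,n} (modelled as Fin n = {0,…,n-1}),
-- represented by its image vector (x α = lookup α x); Vec (Fin n) n is in
-- bijection with the functions Fin n → Fin n and has decidable equality.
Transformation : ℕ → Set
Transformation n = Vec (Fin n) n

_·_ : ∀ {n} → Fin n → Transformation n → Fin n
x · α = lookup α x

dist : ∀ {n} → Fin n → Fin n → ℕ
dist x y = ∣ + toℕ x - + toℕ y ∣

OrderPreserving : ∀ {n} → Transformation n → Set
OrderPreserving {n} α = ∀ (x y : Fin n) → x ≤ y → (x · α) ≤ (y · α)

OrderDecreasing : ∀ {n} → Transformation n → Set
OrderDecreasing {n} α = ∀ (x : Fin n) → (x · α) ≤ x

Contraction : ∀ {n} → Transformation n → Set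
Contraction {n} α = ∀ (x y : Fin n) → dist (x · α) (y · α) ℕ.≤ dist x y

IsODCT : ∀ {n} → Transformation n → Set
IsODCT α = OrderPreserving α × OrderDecreasing α × Contraction α

HasCardinality : ∀ {A : Set} → (A → Set) → ℕ → Set
HasCardinality {A} P k =
  Σ (List A) λ xs → Unique xs × (∀ a → a ∈ xs → P a) × (∀ a → P a → a ∈ xs) × length xs ≡ k

module Submission where

-- Every α ∈ ODCT_{m+2} fixes 0 (it is order-decreasing), and its value at 1 is
-- c ∈ {0,1}.  Monotonicity and contraction between the point 1 and x+1 show that
-- β(x) = α(x+1) - c is again an ODCT on m+1 points, so α = extend c β, where
-- extend c β sends 0 to 0 and x+1 to c + β(x).  Conversely extend c β is an ODCT
-- whenever β is one.  Hence ODCT_{m+2} is the disjoint union of two copies of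
-- ODCT_{m+1} (distinguished by the value at 1), and the enumeration
--   odct 0 = [ id ],   odct (m+1) = map (extend 0) (odct m) ++ map (extend 1) (odct m)
-- lists ODCT_{m+1} exactly once each and has length 2^m.

open import Defs
open import Data.Nat using (ℕ; zero; suc; _+_; _*_; _∸_; _^_; _≥_; z≤n; s≤s; ∣_-_∣)
  renaming (_≤_ to _≤ℕ_)
open import Data.Nat.Properties
  using ( ≤-trans; +-mono-≤; +-monoʳ-≤; +-cancelˡ-≤; +-cancelˡ-≡; +-identityʳ; n≤0⇒n≡0
        ; m+[n∸m]≡n; m≤n⇒∣m-n∣≡n∸m; ∣m+n-m+o∣≡∣n-o∣; ∣-∣-identityʳ)
open import Data.Fin using (Fin; zero; suc; toℕ; inject₁; fromℕ<)
open import Data.Fin.Properties using (toℕ-injective; toℕ-inject₁; toℕ-fromℕ<; toℕ≤pred[n])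
open import Data.Vec using (Vec; []; _∷_; lookup; map; tabulate)
open import Data.Vec.Properties using (lookup-map; lookup∘tabulate; tabulate∘lookup; tabulate-cong)
open import Data.List using (List; length; _++_)
  renaming (_∷_ to _∷ₗ_; [] to []ₗ; map to mapₗ)
open import Data.List.Properties using (length-++; length-map)
open import Data.List.Membership.Propositional using (_∈_)
open import Data.List.Membership.Propositional.Properties using (∈-map⁺; ∈-map⁻; ∈-++⁺ˡ; ∈-++⁺ʳ; ∈-++⁻)
open import Data.List.Relation.Unary.Any using (here)
open import Data.List.Relation.Unary.Unique.Propositional using (Unique)
open import Data.List.Relation.Unary.Unique.Propositional.Properties using (map⁺; ++⁺)
import Data.List.Relation.Unary.All as All
import Data.List.Relation.Unary.AllPairs as AllPairs
open import Data.Integer using (∣_∣; _⊖_)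
open import Data.Integer.Properties using ([+m]-[+n]≡m⊖n; [1+m]⊖[1+n]≡m⊖n)
open import Data.Product using (Σ-syntax; _×_; _,_)
open import Data.Sum using (inj₁; inj₂)
open import Data.Empty using (⊥)
open import Relation.Binary.PropositionalEquality

private variable m : ℕ


∣⊖∣≡∣-∣ : ∀ a b → ∣ a ⊖ b ∣ ≡ ∣ a - b ∣
∣⊖∣≡∣-∣ zero    zero    = refl
∣⊖∣≡∣-∣ zero    (suc b) = refl
∣⊖∣≡∣-∣ (suc a) zero    = refl
∣⊖∣≡∣-∣ (suc a) (suc b) = trans (cong ∣_∣ ([1+m]⊖[1+n]≡m⊖n a b)) (∣⊖∣≡∣-∣ a b)

dist≡∣-∣ : ∀ {n} (x y : Fin n) → dist x y ≡ ∣ toℕ x - toℕ y ∣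
dist≡∣-∣ x y = trans (cong ∣_∣ ([+m]-[+n]≡m⊖n (toℕ x) (toℕ y))) (∣⊖∣≡∣-∣ (toℕ x) (toℕ y))

-- The contraction property read in ℕ, where the arithmetic lemmas live.
Contractionℕ : ∀ {n} → Transformation n → Set
Contractionℕ {n} α = ∀ (x y : Fin n) → ∣ toℕ (x · α) - toℕ (y · α) ∣ ≤ℕ ∣ toℕ x - toℕ y ∣

contraction⇒ℕ : ∀ {n} (α : Transformation n) → Contraction α → Contractionℕ α
contraction⇒ℕ α con x y = subst₂ _≤ℕ_ (dist≡∣-∣ (x · α) (y · α)) (dist≡∣-∣ x y) (con x y)

ℕ⇒contraction : ∀ {n} (α : Transformation n) → Contractionℕ α → Contraction α
ℕ⇒contraction α con x y = subst₂ _≤ℕ_ (sym (dist≡∣-∣ (x · α) (y · α))) (sym (dist≡∣-∣ x y)) (con x y)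

shift : Fin 2 → Fin (suc m) → Fin (suc (suc m))
shift zero       = inject₁
shift (suc zero) = suc

toℕ-shift : (c : Fin 2) (a : Fin (suc m)) → toℕ (shift c a) ≡ toℕ c + toℕ a
toℕ-shift zero       a = toℕ-inject₁ a
toℕ-shift (suc zero) a = refl

extend : Fin 2 → Transformation (suc m) → Transformation (suc (suc m))
extend c β = zero ∷ map (shift c) β

toℕ-extend : (c : Fin 2) (β : Transformation (suc m)) (x : Fin (suc m)) →
             toℕ (suc x · extend c β) ≡ toℕ c + toℕ (x · β)
toℕ-extend c β x = trans (cong toℕ (lookup-map x (shift c) β)) (toℕ-shift c (x · β))

extend-distance : (c : Fin 2) (β : Transformation (suc m)) (x y : Fin (suc m)) →
                  ∣ toℕ (suc x · extend c β) - toℕ (suc y · extend c β) ∣ ≡ ∣ toℕ (x · β) - toℕ (y · β) ∣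
extend-distance c β x y =
  trans (cong₂ ∣_-_∣ (toℕ-extend c β x) (toℕ-extend c β y)) (∣m+n-m+o∣≡∣n-o∣ (toℕ c) _ _)

-- extend c maps ODCT_{m+1} into ODCT_{m+2}: as c ≤ 1, the value c + β(x) stays below
-- x+1, which is both the order-decreasing bound and the distance from the point 0.
extend-ODCT : (c : Fin 2) {β : Transformation (suc m)} → IsODCT β → IsODCT (extend c β)
extend-ODCT c {β} (op , dec , con) = op′ , dec′ , ℕ⇒contraction α con′
  where
  α = extend c β
  below : ∀ x → toℕ (suc x · α) ≤ℕ suc (toℕ x)
  below x = subst (_≤ℕ suc (toℕ x)) (sym (toℕ-extend c β x)) (+-mono-≤ (toℕ≤pred[n] c) (dec x))
  op′ : OrderPreserving α
  op′ zero    _       _         = z≤n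
  op′ (suc x) zero    ()
  op′ (suc x) (suc y) (s≤s x≤y) = subst₂ _≤ℕ_ (sym (toℕ-extend c β x)) (sym (toℕ-extend c β y))
                                    (+-monoʳ-≤ (toℕ c) (op x y x≤y))
  dec′ : OrderDecreasing α
  dec′ zero    = z≤n
  dec′ (suc x) = below x
  con′ : Contractionℕ α
  con′ zero    zero    = z≤n
  con′ zero    (suc y) = below y
  con′ (suc x) zero    = subst (_≤ℕ suc (toℕ x)) (sym (∣-∣-identityʳ _)) (below x)
  con′ (suc x) (suc y) = subst (_≤ℕ ∣ toℕ x - toℕ y ∣) (sym (extend-distance c β x y))
                           (contraction⇒ℕ β con x y)

-- Conversely β is an ODCT when extend c β is, provided β is order-decreasing
-- (this is not automatic: c = 0 with β(0) = 1 gives an ODCT extend c β).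
restrict-ODCT : (c : Fin 2) {β : Transformation (suc m)} →
                IsODCT (extend c β) → OrderDecreasing β → IsODCT β
restrict-ODCT c {β} (op , _ , con) dec = op′ , dec , ℕ⇒contraction β con′
  where
  op′ : OrderPreserving β
  op′ x y x≤y = +-cancelˡ-≤ (toℕ c) _ _
    (subst₂ _≤ℕ_ (toℕ-extend c β x) (toℕ-extend c β y) (op (suc x) (suc y) (s≤s x≤y)))
  con′ : Contractionℕ β
  con′ x y = subst (_≤ℕ ∣ toℕ x - toℕ y ∣) (extend-distance c β x y) (contraction⇒ℕ (extend c β) con (suc x) (suc y))

lookup-ext : ∀ {A : Set} {n} {u v : Vec A n} → (∀ i → lookup u i ≡ lookup v i) → u ≡ v
lookup-ext {u = u} {v} eq = trans (sym (tabulate∘lookup u)) (trans (tabulate-cong eq) (tabulate∘lookup v))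

fixes-zero : {α : Transformation (suc m)} → OrderDecreasing α → zero · α ≡ zero
fixes-zero dec = toℕ-injective (n≤0⇒n≡0 (dec zero))

-- Every α ∈ ODCT_{m+2} is extend c β with c = α(1) and β(x) = α(x+1) - α(1) in ODCT_{m+1}.
-- Monotonicity gives α(1) ≤ α(x+1); contraction between 1 and x+1 gives the bound
-- α(x+1) - α(1) ≤ x, which makes β well defined and order-decreasing.
decompose : {α : Transformation (suc (suc m))} → IsODCT α →
            Σ[ c ∈ Fin 2 ] Σ[ β ∈ Transformation (suc m) ] IsODCT β × α ≡ extend c β
decompose {m} {α} α-odct@(op , dec , con) =
  c , β , restrict-ODCT c (subst IsODCT α≡extend α-odct) β-dec , α≡extend
  where
  a : Fin (suc m) → ℕ
  a x = toℕ (suc x · α)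
  a₀≤a : ∀ x → a zero ≤ℕ a x
  a₀≤a x = op (suc zero) (suc x) (s≤s z≤n)
  rise : ∀ x → a x ∸ a zero ≤ℕ toℕ x
  rise x = subst (_≤ℕ toℕ x) (m≤n⇒∣m-n∣≡n∸m (a₀≤a x)) (contraction⇒ℕ α con (suc zero) (suc x))
  c : Fin 2
  c = fromℕ< (s≤s (dec (suc zero)))
  β-entry : Fin (suc m) → Fin (suc m)
  β-entry x = fromℕ< (s≤s (≤-trans (rise x) (toℕ≤pred[n] x)))
  β : Transformation (suc m)
  β = tabulate β-entry
  toℕ-β : ∀ x → toℕ (x · β) ≡ a x ∸ a zero
  toℕ-β x = trans (cong toℕ (lookup∘tabulate β-entry x)) (toℕ-fromℕ< _)
  β-dec : OrderDecreasing β
  β-dec x = subst (_≤ℕ toℕ x) (sym (toℕ-β x)) (rise x)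
  tail-values : ∀ x → a x ≡ toℕ (suc x · extend c β)
  tail-values x = begin
    a x                      ≡⟨ sym (m+[n∸m]≡n (a₀≤a x)) ⟩
    a zero + (a x ∸ a zero)  ≡⟨ cong₂ _+_ (sym (toℕ-fromℕ< _)) (sym (toℕ-β x)) ⟩
    toℕ c + toℕ (x · β)      ≡⟨ sym (toℕ-extend c β x) ⟩
    toℕ (suc x · extend c β) ∎
    where open ≡-Reasoning
  α≡extend : α ≡ extend c β
  α≡extend = lookup-ext λ { zero → fixes-zero {α = α} dec ; (suc x) → toℕ-injective (tail-values x) }

extend-injective : (c : Fin 2) {β β′ : Transformation (suc m)} → extend c β ≡ extend c β′ → β ≡ β′
extend-injective c {β} {β′} eq = lookup-ext λ x → toℕ-injective (+-cancelˡ-≡ (toℕ c) _ _ (begin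
  toℕ c + toℕ (x · β)       ≡⟨ sym (toℕ-extend c β x) ⟩
  toℕ (suc x · extend c β)  ≡⟨ cong (λ α → toℕ (suc x · α)) eq ⟩
  toℕ (suc x · extend c β′) ≡⟨ toℕ-extend c β′ x ⟩
  toℕ c + toℕ (x · β′)      ∎))
  where open ≡-Reasoning

extend-at-one : (c : Fin 2) {β : Transformation (suc m)} → zero · β ≡ zero →
                toℕ (suc zero · extend c β) ≡ toℕ c
extend-at-one c {β} β-fix =
  trans (toℕ-extend c β zero) (trans (cong (λ b → toℕ c + toℕ b) β-fix) (+-identityʳ (toℕ c)))

extensions : List (Transformation (suc m)) → List (Transformation (suc (suc m)))
extensions βs = mapₗ (extend zero) βs ++ mapₗ (extend (suc zero)) βs

∈-extensions⁺ : (c : Fin 2) {β : Transformation (suc m)} {βs : List (Transformation (suc m))} →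
                β ∈ βs → extend c β ∈ extensions βs
∈-extensions⁺ zero       β∈ = ∈-++⁺ˡ (∈-map⁺ (extend zero) β∈)
∈-extensions⁺ (suc zero) {βs = βs} β∈ = ∈-++⁺ʳ (mapₗ (extend zero) βs) (∈-map⁺ (extend (suc zero)) β∈)

∈-extensions⁻ : {α : Transformation (suc (suc m))} (βs : List (Transformation (suc m))) →
                α ∈ extensions βs → Σ[ c ∈ Fin 2 ] Σ[ β ∈ Transformation (suc m) ] β ∈ βs × α ≡ extend c β
∈-extensions⁻ βs α∈ with ∈-++⁻ (mapₗ (extend zero) βs) α∈
... | inj₁ α∈₀ = let β , β∈ , eq = ∈-map⁻ (extend zero) α∈₀ in zero , β , β∈ , eq
... | inj₂ α∈₁ = let β , β∈ , eq = ∈-map⁻ (extend (suc zero)) α∈₁ in suc zero , β , β∈ , eq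

-- The two families of extensions are disjoint (they differ at the point 1) as long as
-- every listed transformation fixes 0, so extensions preserves duplicate-freeness.
extensions-unique : {βs : List (Transformation (suc m))} → (∀ {β} → β ∈ βs → zero · β ≡ zero) →
                    Unique βs → Unique (extensions βs)
extensions-unique {βs = βs} fix βs-unique =
  ++⁺ (map⁺ (extend-injective zero) βs-unique) (map⁺ (extend-injective (suc zero)) βs-unique) disjoint
  where
  disjoint : ∀ {α} → α ∈ mapₗ (extend zero) βs × α ∈ mapₗ (extend (suc zero)) βs → ⊥
  disjoint (α∈₀ , α∈₁) with ∈-map⁻ (extend zero) α∈₀ | ∈-map⁻ (extend (suc zero)) α∈₁
  ... | β , β∈ , refl | β′ , β′∈ , eq with
        trans (sym (extend-at-one zero {β} (fix β∈)))
              (trans (cong (λ α → toℕ (suc zero · α)) eq) (extend-at-one (suc zero) {β′} (fix β′∈)))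
  ... | ()

length-extensions : (βs : List (Transformation (suc m))) → length (extensions βs) ≡ 2 * length βs
length-extensions βs = begin
  length (mapₗ (extend zero) βs ++ mapₗ (extend (suc zero)) βs)
    ≡⟨ length-++ (mapₗ (extend zero) βs) ⟩
  length (mapₗ (extend zero) βs) + length (mapₗ (extend (suc zero)) βs)
    ≡⟨ cong₂ _+_ (length-map (extend zero) βs) (length-map (extend (suc zero)) βs) ⟩
  length βs + length βs
    ≡⟨ cong (length βs +_) (sym (+-identityʳ (length βs))) ⟩
  2 * length βs ∎
  where open ≡-Reasoning

odct : (m : ℕ) → List (Transformation (suc m))
odct zero    = (zero ∷ []) ∷ₗ []ₗ
odct (suc m) = extensions (odct m)

identity₁-ODCT : IsODCT {1} (zero ∷ [])
identity₁-ODCT = (λ { zero zero _ → z≤n }) , (λ { zero → z≤n }) , (λ { zero zero → z≤n })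

odct-sound : (m : ℕ) {α : Transformation (suc m)} → α ∈ odct m → IsODCT α
odct-sound zero    (here refl) = identity₁-ODCT
odct-sound (suc m) α∈ with ∈-extensions⁻ (odct m) α∈
... | c , β , β∈ , refl = extend-ODCT c (odct-sound m β∈)

odct-complete : (m : ℕ) {α : Transformation (suc m)} → IsODCT α → α ∈ odct m
odct-complete zero    {zero ∷ []} _ = here refl
odct-complete (suc m) {α} α-odct with decompose {α = α} α-odct
... | c , β , β-odct , refl = ∈-extensions⁺ c (odct-complete m β-odct)

odct-unique : (m : ℕ) → Unique (odct m)
odct-unique zero    = All.[] AllPairs.∷ AllPairs.[]
odct-unique (suc m) =
  extensions-unique (λ {β} β∈ → let _ , dec , _ = odct-sound m β∈ in fixes-zero {α = β} dec) (odct-unique m)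

odct-length : (m : ℕ) → length (odct m) ≡ 2 ^ m
odct-length zero    = refl
odct-length (suc m) = trans (length-extensions (odct m)) (cong (2 *_) (odct-length m))

corollary4p6 : (n : ℕ) → n ≥ 1 → HasCardinality (IsODCT {n}) (2 ^ (n ∸ 1))
corollary4p6 (suc m) _ = odct m , odct-unique m , (λ _ → odct-sound m) , (λ _ → odct-complete m) , odct-length m
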